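{- Let $V\subset\mathbb{R}^d$ be finite with $\dim(\mathrm{conv}(V))=d$, and let $S$ be a subdivision of $V$. Suppose $T$ is the triangulation obtained by refining $S$ by pulling and/or pushing the points of $V$ in the order $v^1,\dots,v^n$ (each with a fixed choice of pull or push). Then for each $S_i\in S$, the triangulation of $S_i$ formed by the simplices of $T$ contained in $S_i$ is the triangulation of $S_i$ obtained from the trivial subdivision $\{S_i\}$ by pulling and/or pushing the points of $S_i$ in the induced order (with the same pull/push choices).
   Context: A face of a finite set $X$ is $\emptyset$ or $X\cap H$ for a supporting hyperplane $H$; a facet is a face of dimension $\dim\mathrm{conv}(X)-1$. A subdivision of $V$ is a collection of subsets of $V$ with $d$-dimensional convex hulls covering $\mathrm{conv}(V)$, any two meeting in a common (possibly empty) face; a triangulation if each set has $d+1$ points. A facet $F$ of a $d$-dimensional finite set $X$ is visible from $v$ if $v$ lies in the open halfspace bounded by $\mathrm{aff}(F)$ not containing $\mathrm{conv}(X)$. Pulling $v$ in a subdivision: sets not containing $v$ are kept, and each set $S_j\ni v$ is replaced by all $F\cup\{v\}$ with $F$ a facet of $S_j$ not containing $v$. Pushing $v$: sets not containing $v$ are kept; $S_j\ni v$ with $\mathrm{conv}(S_j-\{v\})$ of dimension $d-1$ is kept; $S_j\ni v$ with $\mathrm{conv}(S_j-\{v\})$ $d$-dimensional is replaced by $S_j-\{v\}$ and all $F\cup\{v\}$ with $F$ a facet of $S_j-\{v\}$ visible from $v$. Pulling/pushing a point contained in no set changes nothing. -}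

module Defs where

open import Level using (0ℓ)
open import Data.Nat as ℕ using (ℕ; zero; suc)
open import Data.Fin using (Fin; zero; suc)
open import Data.Fin.Subset using (Subset; _∈_; _∉_; _⊆_; _∩_; _∪_; _-_; ⁅_⁆; ∣_∣; ⊤)
open import Data.Fin.Subset.Properties using (_∈?_)
open import Data.Bool using (Bool; true; false)
open import Data.List using (List; []; _∷_; map; filter; foldl)
open import Data.List.Base using (allFin)
open import Data.Product using (Σ; ∃; ∃-syntax; _×_; _,_; proj₁)
open import Data.Sum using (_⊎_)
open import Relation.Binary.PropositionalEquality using (_≡_; _≢_)
open import Relation.Binary.Structures using (IsStrictTotalOrder)
open import Algebra.Structures using (IsCommutativeRing)
open import Relation.Nullary using (¬_)

-- An abstract model of the real numbers: a Dedekind-complete ordered field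
-- (with propositional equality on the carrier).  Every such structure is
-- (classically) isomorphic to ℝ.
record RealField : Set₁ where
  infixl 6 _+_
  infixl 7 _*_
  infix 4 _<_ _≤_
  field
    Carrier : Set
    _+_ _*_ : Carrier → Carrier → Carrier
    -_      : Carrier → Carrier
    0# 1#   : Carrier
    _<_     : Carrier → Carrier → Set
    isCommutativeRing : IsCommutativeRing _≡_ _+_ _*_ -_ 0# 1#
    0≢1     : 0# ≢ 1#
    inverse : ∀ x → x ≢ 0# → ∃[ y ] (x * y ≡ 1#)
    isStrictTotalOrder : IsStrictTotalOrder _≡_ _<_
    +-mono-< : ∀ {x y} z → x < y → x + z < y + z
    *-pos    : ∀ {x y} → 0# < x → 0# < y → 0# < x * y
  _≤_ : Carrier → Carrier → Set
  x ≤ y = x < y ⊎ x ≡ y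
  field
    complete : (P : Carrier → Set) → ∃ P → (∃[ b ] (∀ x → P x → x ≤ b)) →
               ∃[ s ] ((∀ x → P x → x ≤ s) × (∀ b → (∀ x → P x → x ≤ b) → s ≤ b))

_⇔_ : Set → Set → Set
A ⇔ B = (A → B) × (B → A)

-- Geometry of a finite point configuration V = {V i | i : Fin n} ⊂ R^d.
-- Subsets of V are represented as subsets of the index set Fin n.
module Geometry (R : RealField) (d n : ℕ) (V : Fin n → Fin d → RealField.Carrier R) where
  open RealField R

  Σ[_] : ∀ {m} → (Fin m → Carrier) → Carrier
  Σ[_] {zero}  f = 0#
  Σ[_] {suc m} f = f zero + Σ[_] (λ i → f (suc i))

  _·_ : (Fin d → Carrier) → Fin n → Carrier
  a · i = Σ[ (λ j → a j * V i j) ]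

  Point : Set
  Point = Fin d → Carrier

  InConv : Subset n → Point → Set
  InConv X p = ∃[ w ] ((∀ i → 0# ≤ w i) × (∀ i → i ∉ X → w i ≡ 0#) ×
                       (Σ[ w ] ≡ 1#) × (∀ j → Σ[ (λ i → w i * V i j) ] ≡ p j))

  AffIndep : Subset n → Set
  AffIndep Y = ∀ (w : Fin n → Carrier) → (∀ i → i ∉ Y → w i ≡ 0#) →
               Σ[ w ] ≡ 0# → (∀ j → Σ[ (λ i → w i * V i j) ] ≡ 0#) → ∀ i → w i ≡ 0#

  -- AffRank X r : dim conv(X) = r - 1  (r = maximal number of affinely
  -- independent points of X; r = 0 iff X = ∅)
  AffRank : Subset n → ℕ → Set
  AffRank X r = (∃[ Y ] (Y ⊆ X × AffIndep Y × ∣ Y ∣ ≡ r)) ×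
                (∀ Y → Y ⊆ X → AffIndep Y → ∣ Y ∣ ℕ.≤ r)

  Empty : Subset n → Set
  Empty F = ∀ i → i ∉ F

  Face : Subset n → Subset n → Set
  Face X F = Empty F ⊎
    (∃[ a ] ∃[ b ] ((¬ (∀ j → a j ≡ 0#)) × (∀ i → i ∈ X → a · i ≤ b) ×
                    (∀ i → (i ∈ F) ⇔ (i ∈ X × a · i ≡ b))))

  Facet : Subset n → Subset n → Set
  Facet X F = Face X F × ∃[ r ] (AffRank X (suc r) × AffRank F r)

  Visible : Subset n → Subset n → Fin n → Set
  Visible X F v = ∃[ a ] ∃[ b ] ((¬ (∀ j → a j ≡ 0#)) × (∀ i → i ∈ F → a · i ≡ b) ×
                                 (∀ i → i ∈ X → a · i ≤ b) × (b < a · v))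

  Coll : Set₁
  Coll = Subset n → Set

  _≐_ : Coll → Coll → Set
  C ≐ D = ∀ X → C X ⇔ D X

  Subdivision : Coll → Set
  Subdivision C =
    (∀ X → C X → AffRank X (suc d)) ×
    (∀ p → InConv ⊤ p → ∃[ X ] (C X × InConv X p)) ×
    (∀ X Y → C X → C Y → X ≢ Y →
       Face X (X ∩ Y) × Face Y (X ∩ Y) ×
       (∀ p → InConv X p → InConv Y p → InConv (X ∩ Y) p))

  Triangulation : Coll → Set
  Triangulation C = Subdivision C × (∀ X → C X → ∣ X ∣ ≡ suc d)

  Pull : Fin n → Coll → Coll
  Pull v C X = (C X × v ∉ X) ⊎
    ∃[ S ] (C S × v ∈ S × ∃[ F ] (Facet S F × v ∉ F × X ≡ F ∪ ⁅ v ⁆))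

  Push : Fin n → Coll → Coll
  Push v C X = (C X × v ∉ X) ⊎ (C X × v ∈ X × AffRank (X - v) d) ⊎
    ∃[ S ] (C S × v ∈ S × AffRank (S - v) (suc d) ×
            (X ≡ S - v ⊎ ∃[ F ] (Facet (S - v) F × Visible (S - v) F v × X ≡ F ∪ ⁅ v ⁆)))

  Step : Coll → Fin n × Bool → Coll
  Step C (v , true)  = Pull v C
  Step C (v , false) = Push v C

  Run : List (Fin n × Bool) → Coll → Coll
  Run steps C = foldl Step C steps

  sequence : (Fin n → Fin n) → (Fin n → Bool) → List (Fin n × Bool)
  sequence σ c = map (λ k → (σ k , c k)) (allFin n)

  induced : Subset n → List (Fin n × Bool) → List (Fin n × Bool)
  induced S = filter (λ p → proj₁ p ∈? S)

  trivial : Subset n → Coll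
  trivial S X = X ≡ S

-- Call a set full-dimensional if it contains d+1 affinely independent points.
-- Every set produced by pulling or pushing is full-dimensional and lies inside
-- the set it replaces, so by induction every set of the refinement is a
-- full-dimensional subset of a cell of S. A full-dimensional set lies in at
-- most one cell of a subdivision (if two distinct cells shared it, the
-- supporting hyperplane of their common face would contain d+1 independent
-- points of a cell, hence the whole cell). Consequently restricting to a
-- cell S_i commutes with each pull/push step, a step at a point outside S_i
-- does nothing to the restricted collection, and the restriction of S
-- itself is the trivial subdivision {S_i}.

module Submission where

open import Defs
open import Data.Nat using (ℕ; suc)
open import Data.Fin using (Fin)
open import Data.Fin.Subset using (_⊆_; ⊤)
open import Data.Bool using (Bool)
open import Data.Product using (_×_)
open import Function.Definitions using (Injective)
open import Relation.Binary.PropositionalEquality using (_≡_)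

open import Level using (0ℓ)
open import Algebra.Bundles using (CommutativeRing)
import Algebra.Properties.CommutativeSemigroup as CommutativeSemigroupProperties
import Algebra.Properties.Ring as RingProperties
import Algebra.Properties.Semiring.Sum as SemiringSum
open import Data.Nat using (zero; _≤_; _<_; s≤s⁻¹)
open import Data.Nat.Properties using (≤-trans; ≤-reflexive; ≤-<-trans; <⇒≱)
open import Data.Fin using (zero; suc; punchIn)
open import Data.Fin.Properties using (punchInᵢ≢i) renaming (_≟_ to _≟ᶠ_)
open import Data.Fin.Subset using (Subset; Nonempty; _∈_; _∉_; _∪_; _-_; ⁅_⁆; ∣_∣)
open import Data.Fin.Subset.Properties
  using (_∈?_; nonempty?; Empty-unique; ∣⊥∣≡0; ⊆-trans; ⊆-antisym; p⊆p∪q; p─q⊆p;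
         p⊂q⇒∣p∣<∣q∣; x∈p∪q⁺; x∈p∪q⁻; x∈p∩q⁺; x∈p∩q⁻; x∈⁅x⁆; x∈⁅y⁆⇒x≡y)
open import Data.Bool using (true; false) renaming (_≟_ to _≟ᵇ_)
open import Data.Vec.Properties using (≡-dec)
open import Data.List using ([]; _∷_)
open import Data.Product using (∃-syntax; _,_; proj₁; proj₂)
open import Data.Sum using (_⊎_; inj₁; inj₂; [_,_]′)
open import Data.Empty using (⊥-elim)
open import Function using (_∘_; id)
open import Relation.Nullary using (yes; no; contradiction)
open import Relation.Binary.PropositionalEquality
  using (refl; sym; trans; cong; subst; _≢_; module ≡-Reasoning)
open import Relation.Binary.Structures using (IsStrictTotalOrder)

module Refinement (R : RealField) (d n : ℕ) (V : Fin n → Fin d → RealField.Carrier R) where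
  open RealField R using (Carrier; _+_; _*_; -_; 0#; 1#; isCommutativeRing; 0≢1; inverse; isStrictTotalOrder)
  open Geometry R d n V
  open IsStrictTotalOrder isStrictTotalOrder using (irrefl) renaming (_≟_ to _≟ᶜ_)
  open ≡-Reasoning

  private
    ring : CommutativeRing 0ℓ 0ℓ
    ring = record { isCommutativeRing = isCommutativeRing }

  open CommutativeRing ring using (*-assoc; *-identityʳ; zeroˡ; zeroʳ; distribˡ; +-identityʳ; -‿inverseʳ)
  open CommutativeSemigroupProperties (CommutativeRing.*-commutativeSemigroup ring) using (x∙yz≈y∙xz)
  open RingProperties (CommutativeRing.ring ring) using (x∙y⁻¹≈ε⇒x≈y)
  open SemiringSum (CommutativeRing.semiring ring)
    using (sum; sum-syntax; sum-cong-≗; sum-remove; sum-replicate-zero; ∑-distrib-+; ∑-comm; *-distribˡ-sum; *-distribʳ-sum)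

  Σ≡sum : ∀ {m} (f : Fin m → Carrier) → Σ[ f ] ≡ sum f
  Σ≡sum {zero}  f = refl
  Σ≡sum {suc m} f = cong (f zero +_) (Σ≡sum (λ i → f (suc i)))

  sum-single : ∀ {m} (f : Fin m → Carrier) v → (∀ i → i ≢ v → f i ≡ 0#) → sum f ≡ f v
  sum-single {suc m} f v off = begin
    sum f                      ≡⟨ sum-remove {i = v} f ⟩
    f v + sum (f ∘ punchIn v)  ≡⟨ cong (f v +_) (sum-cong-≗ (λ j → off _ (punchInᵢ≢i v j))) ⟩
    f v + ∑[ _ < m ] 0#        ≡⟨ cong (f v +_) (sum-replicate-zero m) ⟩
    f v + 0#                   ≡⟨ +-identityʳ (f v) ⟩
    f v                        ∎

  x*y≡0⇒x≡0 : ∀ {x y} → x * y ≡ 0# → y ≢ 0# → x ≡ 0#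
  x*y≡0⇒x≡0 {x} {y} xy≡0 y≢0 with inverse y y≢0
  ... | y⁻¹ , yy⁻¹≡1 = begin
    x              ≡⟨ sym (*-identityʳ x) ⟩
    x * 1#         ≡⟨ cong (x *_) (sym yy⁻¹≡1) ⟩
    x * (y * y⁻¹)  ≡⟨ sym (*-assoc x y y⁻¹) ⟩
    x * y * y⁻¹    ≡⟨ cong (_* y⁻¹) xy≡0 ⟩
    0# * y⁻¹       ≡⟨ zeroˡ y⁻¹ ⟩
    0#             ∎

  0·≡0 : ∀ i → (λ _ → 0#) · i ≡ 0#
  0·≡0 i = begin
    (λ _ → 0#) · i            ≡⟨ Σ≡sum (λ j → 0# * V i j) ⟩
    ∑[ j < d ] (0# * V i j)   ≡⟨ sum-cong-≗ (λ j → zeroˡ (V i j)) ⟩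
    ∑[ j < d ] 0#             ≡⟨ sum-replicate-zero d ⟩
    0#                        ∎

  AffDependence : (Fin n → Carrier) → Set
  AffDependence w = Σ[ w ] ≡ 0# × (∀ j → Σ[ (λ i → w i * V i j) ] ≡ 0#)

  dependence-kills-linear : ∀ {w} → AffDependence w → ∀ (a : Point) → ∑[ i < n ] (w i * (a · i)) ≡ 0#
  dependence-kills-linear {w} (_ , lin) a = begin
    ∑[ i < n ] (w i * (a · i))                   ≡⟨ sum-cong-≗ (λ i → cong (w i *_) (Σ≡sum (λ j → a j * V i j))) ⟩
    ∑[ i < n ] (w i * ∑[ j < d ] (a j * V i j))  ≡⟨ sum-cong-≗ (λ i → *-distribˡ-sum (w i) (λ j → a j * V i j)) ⟩
    ∑[ i < n ] ∑[ j < d ] (w i * (a j * V i j))  ≡⟨ ∑-comm (λ i j → w i * (a j * V i j)) ⟩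
    ∑[ j < d ] ∑[ i < n ] (w i * (a j * V i j))  ≡⟨ sum-cong-≗ (λ j → sum-cong-≗ (λ i → x∙yz≈y∙xz (w i) (a j) (V i j))) ⟩
    ∑[ j < d ] ∑[ i < n ] (a j * (w i * V i j))  ≡⟨ sum-cong-≗ (λ j → sym (*-distribˡ-sum (a j) (λ i → w i * V i j))) ⟩
    ∑[ j < d ] (a j * ∑[ i < n ] (w i * V i j))  ≡⟨ sum-cong-≗ (λ j → cong (a j *_) (trans (sym (Σ≡sum (λ i → w i * V i j))) (lin j))) ⟩
    ∑[ j < d ] (a j * 0#)                        ≡⟨ sum-cong-≗ (λ j → zeroʳ (a j)) ⟩
    ∑[ j < d ] 0#                                ≡⟨ sum-replicate-zero d ⟩
    0#                                           ∎

  dependence-kills-affine : ∀ {w} → AffDependence w → ∀ (a : Point) b →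
                            ∑[ i < n ] (w i * (a · i + - b)) ≡ 0#
  dependence-kills-affine {w} dep@(Σw≡0 , _) a b = begin
    ∑[ i < n ] (w i * (a · i + - b))                        ≡⟨ sum-cong-≗ (λ i → distribˡ (w i) (a · i) (- b)) ⟩
    ∑[ i < n ] (w i * (a · i) + w i * - b)                  ≡⟨ ∑-distrib-+ (λ i → w i * (a · i)) (λ i → w i * - b) ⟩
    ∑[ i < n ] (w i * (a · i)) + ∑[ i < n ] (w i * - b)     ≡⟨ cong (_+ ∑[ i < n ] (w i * - b)) (dependence-kills-linear dep a) ⟩
    0# + ∑[ i < n ] (w i * - b)                             ≡⟨ cong (0# +_) (sym (*-distribʳ-sum (- b) w)) ⟩
    0# + sum w * - b                                        ≡⟨ cong (λ t → 0# + t * - b) (trans (sym (Σ≡sum w)) Σw≡0) ⟩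
    0# + 0# * - b                                           ≡⟨ cong (0# +_) (zeroˡ (- b)) ⟩
    0# + 0#                                                 ≡⟨ +-identityʳ 0# ⟩
    0#                                                      ∎

  ∪⁅⁆-least : ∀ {p q : Subset n} {x} → p ⊆ q → x ∈ q → p ∪ ⁅ x ⁆ ⊆ q
  ∪⁅⁆-least {p} {x = x} p⊆q x∈q y∈p∪x with x∈p∪q⁻ p ⁅ x ⁆ y∈p∪x
  ... | inj₁ y∈p = p⊆q y∈p
  ... | inj₂ y∈x = subst (_∈ _) (sym (x∈⁅y⁆⇒x≡y x y∈x)) x∈q

  ∣p∣<∣p∪⁅x⁆∣ : ∀ {p : Subset n} {x} → x ∉ p → ∣ p ∣ < ∣ p ∪ ⁅ x ⁆ ∣
  ∣p∣<∣p∪⁅x⁆∣ {x = x} x∉p = p⊂q⇒∣p∣<∣q∣ (p⊆p∪q _ , x , x∈p∪q⁺ (inj₂ (x∈⁅x⁆ x)) , x∉p)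

  -- The weight of the new point v in a dependence of Y ∪ {v} is killed by an
  -- affine function vanishing on Y but not at v.
  AffIndep-∪⁅⁆ : ∀ {Y v} (a : Point) b → (∀ i → i ∈ Y → a · i ≡ b) → a · v ≢ b →
                 AffIndep Y → AffIndep (Y ∪ ⁅ v ⁆)
  AffIndep-∪⁅⁆ {Y} {v} a b onY off indY w out Σw≡0 lin = indY w out′ Σw≡0 lin
    where
    outside : ∀ {i} → i ∉ Y → i ≢ v → w i ≡ 0#
    outside {i} i∉Y i≢v = out i (λ i∈Y∪v → [ i∉Y , i≢v ∘ x∈⁅y⁆⇒x≡y v ]′ (x∈p∪q⁻ Y ⁅ v ⁆ i∈Y∪v))

    term≡0 : ∀ i → i ≢ v → w i * (a · i + - b) ≡ 0#
    term≡0 i i≢v with i ∈? Y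
    ... | yes i∈Y = begin
      w i * (a · i + - b)  ≡⟨ cong (λ t → w i * (t + - b)) (onY i i∈Y) ⟩
      w i * (b + - b)      ≡⟨ cong (w i *_) (-‿inverseʳ b) ⟩
      w i * 0#             ≡⟨ zeroʳ (w i) ⟩
      0#                   ∎
    ... | no i∉Y = trans (cong (_* (a · i + - b)) (outside i∉Y i≢v)) (zeroˡ _)

    wv≡0 : w v ≡ 0#
    wv≡0 = x*y≡0⇒x≡0
      (trans (sym (sum-single _ v term≡0)) (dependence-kills-affine (Σw≡0 , lin) a b))
      (off ∘ x∙y⁻¹≈ε⇒x≈y (a · v) b)

    out′ : ∀ i → i ∉ Y → w i ≡ 0#
    out′ i i∉Y with i ≟ᶠ v
    ... | yes refl = wv≡0
    ... | no i≢v = outside i∉Y i≢v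

  FullDimensional : Subset n → Set
  FullDimensional X = ∃[ Y ] (Y ⊆ X × AffIndep Y × suc d ≤ ∣ Y ∣)

  AffRank⇒FullDimensional : ∀ {X} → AffRank X (suc d) → FullDimensional X
  AffRank⇒FullDimensional ((Y , Y⊆X , indY , ∣Y∣≡) , _) = Y , Y⊆X , indY , ≤-reflexive (sym ∣Y∣≡)

  FullDimensional⇒rank≥ : ∀ {X r} → FullDimensional X → AffRank X r → suc d ≤ r
  FullDimensional⇒rank≥ (Y , Y⊆X , indY , d<∣Y∣) (_ , maximal) = ≤-trans d<∣Y∣ (maximal Y Y⊆X indY)

  FullDimensional⇒Nonempty : ∀ {X} → FullDimensional X → Nonempty X
  FullDimensional⇒Nonempty (Y , Y⊆X , _ , d<∣Y∣) with nonempty? Y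
  ... | yes (x , x∈Y) = x , Y⊆X x∈Y
  ... | no empty with Empty-unique empty
  ...   | refl with subst (suc d ≤_) (∣⊥∣≡0 n) d<∣Y∣
  ...     | ()

  FullDimensional-∪⁅⁆ : ∀ {F v r} (a : Point) b → AffRank F r → d ≤ r →
                        (∀ i → i ∈ F → a · i ≡ b) → a · v ≢ b → FullDimensional (F ∪ ⁅ v ⁆)
  FullDimensional-∪⁅⁆ {v = v} a b ((Y , Y⊆F , indY , ∣Y∣≡r) , _) d≤r onF off =
    Y ∪ ⁅ v ⁆ ,
    ∪⁅⁆-least (⊆-trans Y⊆F (p⊆p∪q _)) (x∈p∪q⁺ (inj₂ (x∈⁅x⁆ v))) ,
    AffIndep-∪⁅⁆ a b onY off indY ,
    ≤-<-trans (≤-trans d≤r (≤-reflexive (sym ∣Y∣≡r))) (∣p∣<∣p∪⁅x⁆∣ (off ∘ onY v))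
    where
    onY : ∀ i → i ∈ Y → a · i ≡ b
    onY i = onF i ∘ Y⊆F

  Face⇒⊆ : ∀ {X F} → Face X F → F ⊆ X
  Face⇒⊆ (inj₁ empty)                 i∈F = ⊥-elim (empty _ i∈F)
  Face⇒⊆ (inj₂ (_ , _ , _ , _ , iff)) i∈F = proj₁ (proj₁ (iff _) i∈F)

  Face⇒separating-hyperplane : ∀ {X F v} → Face X F → v ∈ X → v ∉ F →
                               ∃[ a ] ∃[ b ] ((∀ i → i ∈ F → a · i ≡ b) × a · v ≢ b)
  Face⇒separating-hyperplane {v = v} (inj₁ empty) _ _ =
    (λ _ → 0#) , 1# , (λ i i∈F → ⊥-elim (empty i i∈F)) , 0≢1 ∘ trans (sym (0·≡0 v))
  Face⇒separating-hyperplane {v = v} (inj₂ (a , b , _ , _ , iff)) v∈X v∉F =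
    a , b , (λ i i∈F → proj₂ (proj₁ (iff i) i∈F)) , (λ av≡b → v∉F (proj₂ (iff v) (v∈X , av≡b)))

  pulled-cell : ∀ {S F v} → FullDimensional S → v ∈ S → Facet S F → v ∉ F →
                F ∪ ⁅ v ⁆ ⊆ S × FullDimensional (F ∪ ⁅ v ⁆)
  pulled-cell fdS v∈S (face , r , rkS , rkF) v∉F with Face⇒separating-hyperplane face v∈S v∉F
  ... | a , b , onF , off =
    ∪⁅⁆-least (Face⇒⊆ face) v∈S ,
    FullDimensional-∪⁅⁆ a b rkF (s≤s⁻¹ (FullDimensional⇒rank≥ fdS rkS)) onF off

  PushedCell : Subset n → Fin n → Subset n → Set
  PushedCell S v X = X ≡ S - v ⊎ ∃[ F ] (Facet (S - v) F × Visible (S - v) F v × X ≡ F ∪ ⁅ v ⁆)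

  pushed-cell : ∀ {S v X} → v ∈ S → AffRank (S - v) (suc d) → PushedCell S v X →
                X ⊆ S × FullDimensional X
  pushed-cell v∈S rk (inj₁ refl) = p─q⊆p _ _ , AffRank⇒FullDimensional rk
  pushed-cell v∈S rk (inj₂ (F , (face , r , rkS , rkF) , (a , b , _ , onF , _ , b<av) , refl)) =
    ∪⁅⁆-least (⊆-trans (Face⇒⊆ face) (p─q⊆p _ _)) v∈S ,
    FullDimensional-∪⁅⁆ a b rkF (s≤s⁻¹ (FullDimensional⇒rank≥ (AffRank⇒FullDimensional rk) rkS))
                        onF (λ av≡b → irrefl (sym av≡b) b<av)

  ≐-refl : ∀ {C} → C ≐ C
  ≐-refl X = id , id

  ≐-trans : ∀ {C D E} → C ≐ D → D ≐ E → C ≐ E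
  ≐-trans C≐D D≐E X = proj₁ (D≐E X) ∘ proj₁ (C≐D X) , proj₂ (C≐D X) ∘ proj₂ (D≐E X)

  ≐-sym : ∀ {C D} → C ≐ D → D ≐ C
  ≐-sym C≐D X = proj₂ (C≐D X) , proj₁ (C≐D X)

  Step-cong : ∀ {C D} s → C ≐ D → Step C s ≐ Step D s
  Step-cong s C≐D X = to s C≐D , to s (≐-sym C≐D)
    where
    to : ∀ {C D} s → C ≐ D → Step C s X → Step D s X
    to (v , true)  C≐D (inj₁ (cX , v∉X))        = inj₁ (proj₁ (C≐D X) cX , v∉X)
    to (v , true)  C≐D (inj₂ (S , cS , new))     = inj₂ (S , proj₁ (C≐D S) cS , new)
    to (v , false) C≐D (inj₁ (cX , v∉X))        = inj₁ (proj₁ (C≐D X) cX , v∉X)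
    to (v , false) C≐D (inj₂ (inj₁ (cX , kept))) = inj₂ (inj₁ (proj₁ (C≐D X) cX , kept))
    to (v , false) C≐D (inj₂ (inj₂ (S , cS , new))) = inj₂ (inj₂ (S , proj₁ (C≐D S) cS , new))

  Run-cong : ∀ ss {C D} → C ≐ D → Run ss C ≐ Run ss D
  Run-cong []       C≐D = C≐D
  Run-cong (s ∷ ss) C≐D = Run-cong ss (Step-cong s C≐D)

  Step-unused : ∀ {C} s → (∀ X → C X → proj₁ s ∉ X) → Step C s ≐ C
  Step-unused {C} (v , c) unused X = to c , from c
    where
    from : ∀ c → C X → Step C (v , c) X
    from true  cX = inj₁ (cX , unused X cX)
    from false cX = inj₁ (cX , unused X cX)

    to : ∀ c → Step C (v , c) X → C X
    to true  (inj₁ (cX , _))                    = cX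
    to true  (inj₂ (S , cS , v∈S , _))          = ⊥-elim (unused S cS v∈S)
    to false (inj₁ (cX , _))                    = cX
    to false (inj₂ (inj₁ (cX , v∈X , _)))       = ⊥-elim (unused X cX v∈X)
    to false (inj₂ (inj₂ (S , cS , v∈S , _)))   = ⊥-elim (unused S cS v∈S)

  Refines : Coll → Coll → Set
  Refines C S = ∀ X → C X → FullDimensional X × ∃[ T ] (S T × X ⊆ T)

  Refines-Step : ∀ {C S} s → Refines C S → Refines (Step C s) S
  Refines-Step (v , true) ref X (inj₁ (cX , _)) = ref X cX
  Refines-Step (v , true) ref X (inj₂ (S′ , cS′ , v∈S′ , F , facet , v∉F , refl))
    with ref S′ cS′
  ... | fdS′ , T , sT , S′⊆T with pulled-cell fdS′ v∈S′ facet v∉F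
  ...   | X⊆S′ , fdX = fdX , T , sT , ⊆-trans X⊆S′ S′⊆T
  Refines-Step (v , false) ref X (inj₁ (cX , _)) = ref X cX
  Refines-Step (v , false) ref X (inj₂ (inj₁ (cX , _))) = ref X cX
  Refines-Step (v , false) ref X (inj₂ (inj₂ (S′ , cS′ , v∈S′ , rk , new)))
    with ref S′ cS′ | pushed-cell v∈S′ rk new
  ... | _ , T , sT , S′⊆T | X⊆S′ , fdX = fdX , T , sT , ⊆-trans X⊆S′ S′⊆T

  restrict : Subset n → Coll → Coll
  restrict Si C X = C X × X ⊆ Si

  module _ {S : Coll} (sub : Subdivision S) where

    Subdivision⇒Refines : Refines S S
    Subdivision⇒Refines X sX = AffRank⇒FullDimensional (proj₁ sub X sX) , X , sX , id

    hyperplane-spreads : ∀ {X Z} (a : Point) b → AffRank X (suc d) → Z ⊆ X → FullDimensional Z →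
                         (∀ i → i ∈ Z → a · i ≡ b) → ∀ i → i ∈ X → a · i ≡ b
    hyperplane-spreads a b (_ , maximal) Z⊆X (Y , Y⊆Z , indY , d<∣Y∣) onZ i i∈X with (a · i) ≟ᶜ b
    ... | yes on = on
    ... | no off = contradiction
      (maximal (Y ∪ ⁅ i ⁆) (∪⁅⁆-least (⊆-trans Y⊆Z Z⊆X) i∈X) (AffIndep-∪⁅⁆ a b onY off indY))
      (<⇒≱ (≤-<-trans d<∣Y∣ (∣p∣<∣p∪⁅x⁆∣ (off ∘ onY i))))
      where
      onY : ∀ j → j ∈ Y → a · j ≡ b
      onY j = onZ j ∘ Y⊆Z

    shared-FullDimensional⇒⊆ : ∀ {T T′ Z} → S T → S T′ → Z ⊆ T → Z ⊆ T′ → FullDimensional Z → T ⊆ T′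
    shared-FullDimensional⇒⊆ {T} {T′} sT sT′ Z⊆T Z⊆T′ fdZ with ≡-dec _≟ᵇ_ T T′
    ... | yes refl = id
    ... | no T≢T′ with proj₁ (proj₂ (proj₂ sub) T T′ sT sT′ T≢T′)
    ...   | inj₁ empty with FullDimensional⇒Nonempty fdZ
    ...     | x , x∈Z = ⊥-elim (empty x (x∈p∩q⁺ (Z⊆T x∈Z , Z⊆T′ x∈Z)))
    shared-FullDimensional⇒⊆ {T} {T′} sT sT′ Z⊆T Z⊆T′ fdZ
        | no T≢T′ | inj₂ (a , b , _ , _ , iff) =
      λ i∈T → proj₂ (x∈p∩q⁻ T T′ (proj₂ (iff _) (i∈T , onT _ i∈T)))
      where
      onT : ∀ i → i ∈ T → a · i ≡ b
      onT = hyperplane-spreads a b (proj₁ sub T sT) Z⊆T fdZ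
              (λ i i∈Z → proj₂ (proj₁ (iff i) (x∈p∩q⁺ (Z⊆T i∈Z , Z⊆T′ i∈Z))))

    FullDimensional⇒unique-cell : ∀ {T T′ Z} → S T → S T′ → Z ⊆ T → Z ⊆ T′ → FullDimensional Z → T ≡ T′
    FullDimensional⇒unique-cell sT sT′ Z⊆T Z⊆T′ fdZ =
      ⊆-antisym (shared-FullDimensional⇒⊆ sT sT′ Z⊆T Z⊆T′ fdZ)
                (shared-FullDimensional⇒⊆ sT′ sT Z⊆T′ Z⊆T fdZ)

    module _ {Si : Subset n} (sSi : S Si) where

      restrict-cell : restrict Si S ≐ trivial Si
      restrict-cell X = to , λ { refl → sSi , id }
        where
        to : restrict Si S X → X ≡ Si
        to (sX , X⊆Si) = FullDimensional⇒unique-cell sX sSi id X⊆Si (proj₁ (Subdivision⇒Refines X sX))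

      cell-within : ∀ {C S′ X} → Refines C S → C S′ → X ⊆ S′ → FullDimensional X → X ⊆ Si → S′ ⊆ Si
      cell-within ref cS′ X⊆S′ fdX X⊆Si with proj₂ (ref _ cS′)
      ... | T , sT , S′⊆T =
        subst (_ ⊆_) (FullDimensional⇒unique-cell sT sSi (⊆-trans X⊆S′ S′⊆T) X⊆Si fdX) S′⊆T

      restrict-Step : ∀ {C} s → Refines C S → restrict Si (Step C s) ≐ Step (restrict Si C) s
      restrict-Step {C} s ref X = to s , from s
        where
        to : ∀ s → restrict Si (Step C s) X → Step (restrict Si C) s X
        to (v , true) (inj₁ (cX , v∉X) , X⊆Si) = inj₁ ((cX , X⊆Si) , v∉X)
        to (v , true) (inj₂ (S′ , cS′ , v∈S′ , F , facet , v∉F , refl) , X⊆Si)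
          with pulled-cell (proj₁ (ref S′ cS′)) v∈S′ facet v∉F
        ... | X⊆S′ , fdX =
          inj₂ (S′ , (cS′ , cell-within ref cS′ X⊆S′ fdX X⊆Si) , v∈S′ , F , facet , v∉F , refl)
        to (v , false) (inj₁ (cX , v∉X) , X⊆Si) = inj₁ ((cX , X⊆Si) , v∉X)
        to (v , false) (inj₂ (inj₁ (cX , kept)) , X⊆Si) = inj₂ (inj₁ ((cX , X⊆Si) , kept))
        to (v , false) (inj₂ (inj₂ (S′ , cS′ , v∈S′ , rk , new)) , X⊆Si)
          with pushed-cell v∈S′ rk new
        ... | X⊆S′ , fdX =
          inj₂ (inj₂ (S′ , (cS′ , cell-within ref cS′ X⊆S′ fdX X⊆Si) , v∈S′ , rk , new))

        from : ∀ s → Step (restrict Si C) s X → restrict Si (Step C s) X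
        from (v , true) (inj₁ ((cX , X⊆Si) , v∉X)) = inj₁ (cX , v∉X) , X⊆Si
        from (v , true) (inj₂ (S′ , (cS′ , S′⊆Si) , v∈S′ , F , facet , v∉F , refl)) =
          inj₂ (S′ , cS′ , v∈S′ , F , facet , v∉F , refl) ,
          ⊆-trans (proj₁ (pulled-cell (proj₁ (ref S′ cS′)) v∈S′ facet v∉F)) S′⊆Si
        from (v , false) (inj₁ ((cX , X⊆Si) , v∉X)) = inj₁ (cX , v∉X) , X⊆Si
        from (v , false) (inj₂ (inj₁ ((cX , X⊆Si) , kept))) = inj₂ (inj₁ (cX , kept)) , X⊆Si
        from (v , false) (inj₂ (inj₂ (S′ , (cS′ , S′⊆Si) , v∈S′ , rk , new))) =
          inj₂ (inj₂ (S′ , cS′ , v∈S′ , rk , new)) , ⊆-trans (proj₁ (pushed-cell v∈S′ rk new)) S′⊆Si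

      restrict-Run : ∀ ss {C} → Refines C S → restrict Si (Run ss C) ≐ Run (induced Si ss) (restrict Si C)
      restrict-Run [] ref = ≐-refl
      restrict-Run ((v , c) ∷ ss) ref with v ∈? Si
      ... | yes _ =
        ≐-trans (restrict-Run ss (Refines-Step (v , c) ref))
                (Run-cong (induced Si ss) (restrict-Step (v , c) ref))
      ... | no v∉Si =
        ≐-trans (restrict-Run ss (Refines-Step (v , c) ref))
                (Run-cong (induced Si ss)
                  (≐-trans (restrict-Step (v , c) ref)
                           (Step-unused (v , c) (λ X cX v∈X → v∉Si (proj₂ cX v∈X)))))

      restrict-Run-Subdivision : ∀ ss → restrict Si (Run ss S) ≐ Run (induced Si ss) (trivial Si)
      restrict-Run-Subdivision ss =
        ≐-trans (restrict-Run ss Subdivision⇒Refines) (Run-cong (induced Si ss) restrict-cell)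

lemma5p5 : (R : RealField) (d n : ℕ) (V : Fin n → Fin d → RealField.Carrier R) →
    let open Geometry R d n V in
    Injective _≡_ _≡_ V → AffRank ⊤ (suc d) →
    (S : Coll) → Subdivision S →
    (σ : Fin n → Fin n) → Injective _≡_ _≡_ σ → (c : Fin n → Bool) →
    Triangulation (Run (sequence σ c) S) →
    ∀ Si → S Si →
    (λ X → Run (sequence σ c) S X × X ⊆ Si) ≐ Run (induced Si (sequence σ c)) (trivial Si)
lemma5p5 R d n V _ _ S sub σ _ c _ Si sSi =
  Refinement.restrict-Run-Subdivision R d n V sub sSi (Geometry.sequence R d n V σ c)
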